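{- A minimum size 2-CNF encoding $\varphi(\mathbf{x},\mathbf{y})$ of $\mathrm{AMO}_n(\mathbf{x})$ contains no positive occurrence of an input variable, i.e. no clause of $\varphi$ contains a literal $x_i$ with $x_i\in\mathbf{x}$.
   Context: A CNF formula is a conjunction (set) of clauses (disjunctions of literals with no complementary pair); its size is its number of clauses; a 2-CNF formula has all clauses of at most two literals. $\mathrm{AMO}_n(x_1,\dots,x_n)=1$ iff at most one $x_i$ is $1$. A CNF $\varphi(\mathbf{x},\mathbf{y})$ with input variables $\mathbf{x}=(x_1,\dots,x_n)$ and auxiliary variables $\mathbf{y}=(y_1,\dots,y_\ell)$ is an encoding of $f(\mathbf{x})$ if for all $\alpha\in\{0,1\}^n$: $f(\alpha)=1$ iff $\exists\beta\in\{0,1\}^\ell$, $\varphi(\alpha,\beta)=1$. -}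

module Defs where

open import Data.Nat using (ℕ; _≤_)
open import Data.Fin using (Fin)
open import Data.Bool using (Bool; true; false; not)
open import Data.Sum using (_⊎_; inj₁; inj₂)
open import Data.Product using (_×_; ∃; _,_)
open import Data.List using (List; length)
open import Data.List.Membership.Propositional using (_∈_; _∉_)
open import Data.List.Relation.Unary.All using (All)
open import Data.List.Relation.Unary.Any using (Any)
open import Data.List.Relation.Unary.AllPairs using (AllPairs)
open import Data.List.Relation.Unary.Unique.Propositional using (Unique)
open import Data.List.Relation.Binary.Permutation.Propositional using (_↭_)
open import Relation.Binary.PropositionalEquality using (_≡_)
open import Relation.Nullary using (¬_)

-- Variables of a CNF with n input variables x_1..x_n (inj₁) and
-- ℓ auxiliary variables y_1..y_ℓ (inj₂).
Var : ℕ → ℕ → Set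
Var n ℓ = Fin n ⊎ Fin ℓ

data Lit (n ℓ : ℕ) : Set where
  pos : Var n ℓ → Lit n ℓ
  neg : Var n ℓ → Lit n ℓ

-- A clause: a finite set of literals (list without repetitions),
-- containing no complementary pair.
Clause : ℕ → ℕ → Set
Clause n ℓ = List (Lit n ℓ)

WFClause : ∀ {n ℓ} → Clause n ℓ → Set
WFClause {n} {ℓ} C = Unique C × (∀ (v : Var n ℓ) → ¬ (pos v ∈ C × neg v ∈ C))

-- A CNF: a finite set of clauses (list of clauses pairwise distinct as sets).
CNF : ℕ → ℕ → Set
CNF n ℓ = List (Clause n ℓ)

WFCNF : ∀ {n ℓ} → CNF n ℓ → Set
WFCNF φ = All WFClause φ × AllPairs (λ C D → ¬ (C ↭ D)) φ

size : ∀ {n ℓ} → CNF n ℓ → ℕ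
size = length

Is2CNF : ∀ {n ℓ} → CNF n ℓ → Set
Is2CNF φ = All (λ C → length C ≤ 2) φ

evalVar : ∀ {n ℓ} → (Fin n → Bool) → (Fin ℓ → Bool) → Var n ℓ → Bool
evalVar α β (inj₁ i) = α i
evalVar α β (inj₂ j) = β j

evalLit : ∀ {n ℓ} → (Fin n → Bool) → (Fin ℓ → Bool) → Lit n ℓ → Bool
evalLit α β (pos v) = evalVar α β v
evalLit α β (neg v) = not (evalVar α β v)

SatClause : ∀ {n ℓ} → (Fin n → Bool) → (Fin ℓ → Bool) → Clause n ℓ → Set
SatClause α β C = Any (λ l → evalLit α β l ≡ true) C

SatCNF : ∀ {n ℓ} → (Fin n → Bool) → (Fin ℓ → Bool) → CNF n ℓ → Set
SatCNF α β φ = All (SatClause α β) φ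

AMO : ∀ {n} → (Fin n → Bool) → Set
AMO {n} α = ∀ (i j : Fin n) → α i ≡ true → α j ≡ true → i ≡ j

Encodes : ∀ {n ℓ} → CNF n ℓ → ((Fin n → Bool) → Set) → Set
Encodes {n} {ℓ} φ f =
  ∀ (α : Fin n → Bool) → (f α → ∃ λ (β : Fin ℓ → Bool) → SatCNF α β φ)
                       × ((∃ λ (β : Fin ℓ → Bool) → SatCNF α β φ) → f α)

Is2CNFEncodingAMO : ∀ {n ℓ} → CNF n ℓ → Set
Is2CNFEncodingAMO φ = WFCNF φ × Is2CNF φ × Encodes φ AMO

IsMinimum2CNFEncodingAMO : ∀ {n ℓ} → CNF n ℓ → Set
IsMinimum2CNFEncodingAMO {n} φ =
  Is2CNFEncodingAMO φ ×
  (∀ (ℓ' : ℕ) (ψ : CNF n ℓ') → Is2CNFEncodingAMO ψ → size φ ≤ size ψ)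

module Submission where

-- Suppose a clause C of φ contains x_i.  As a well-formed clause of at most two
-- literals, C is x_i ∨ m for a partner literal m ≠ ¬x_i (m = x_i if C = x_i).
--   * m = x_j: the all-zero input satisfies AMO but falsifies C.
--   * m = ¬x_j (so j ≠ i): the input with only x_j set satisfies AMO but
--     falsifies C.
--   * m is a literal over an auxiliary variable y_k: every AMO input has a
--     witness in which m takes a fixed value V, namely the constant 1 if m can
--     be true for the input with only x_i set, and ¬x_i otherwise.  Fixing m to
--     V makes C redundant, so substituting for y_k in the other clauses gives
--     a 2-CNF encoding of AMO_n with fewer clauses; normalising it to a
--     well-formed CNF contradicts minimality.  Since the goal is a negation, classical steps run in
-- the double-negation monad.

open import Defs
open import Level using (0ℓ)
open import Data.Nat using (ℕ; suc; _≤_; z≤n; s≤s)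
open import Data.Nat.Properties using (≤-trans; m≤n⇒m≤1+n; <⇒≱; ≤-reflexive)
open import Data.Fin using (Fin; _≟_)
open import Data.Bool using (Bool; true; false; not)
open import Data.Bool.Properties using (not-involutive)
open import Data.Sum using (_⊎_; inj₁; inj₂; [_,_])
open import Data.Sum.Function.Propositional using (_⊎-⇔_)
import Data.Sum as Sum
open import Data.Product.Function.NonDependent.Propositional using (_×-⇔_)
import Data.Product as Product
open import Data.Product using (_×_; ∃; _,_; proj₁; proj₂)
open import Data.Empty using (⊥)
open import Data.Maybe using (Maybe; just; nothing)
import Data.Maybe as Maybe
open import Data.Maybe.Relation.Unary.All as MaybeAll using (just; nothing)
open import Data.List using (List; []; _∷_; length; _++_)
open import Data.List.Relation.Unary.All as All using (All; []; _∷_)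
open import Data.List.Relation.Unary.All.Properties using (¬Any⇒All¬; anti-mono)
open import Data.List.Relation.Unary.Any as Any using (Any; here; there)
open import Data.List.Relation.Unary.AllPairs using (AllPairs; []; _∷_)
open import Data.List.Membership.Propositional using (_∈_; _∉_; lose)
open import Data.List.Membership.Propositional.Properties using (∈-∃++)
open import Data.List.Relation.Binary.Subset.Propositional using (_⊆_)
open import Data.List.Relation.Binary.Subset.Propositional.Properties using (Any-resp-⊆)
open import Data.List.Relation.Binary.Permutation.Propositional using (_↭_; ↭-refl; ↭-sym)
open import Data.List.Relation.Binary.Permutation.Propositional.Properties
  using (Any-resp-↭; All-resp-↭; ↭-length; shift)
open import Function using (_∘_; id)
open import Function.Bundles using (_⇔_; mk⇔; Equivalence)
open import Function.Properties.Equivalence using (⇔-setoid)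
import Relation.Binary.Reasoning.Setoid as SetoidReasoning
open import Effect.Monad using (RawMonad)
open import Relation.Binary.PropositionalEquality using (_≡_; _≢_; refl; sym; trans; cong; subst)
open import Relation.Nullary using (¬_; Dec; yes; no; does)
open import Relation.Nullary.Decidable using (dec-true; ¬¬-excluded-middle)
open import Relation.Nullary.Negation using (¬¬-Monad; contradiction)
open import Data.Vec.Functional using (updateAt)
open import Data.Vec.Functional.Properties using (updateAt-updates; updateAt-minimal)

open RawMonad (¬¬-Monad {a = 0ℓ}) using (pure; _>>=_)
open Equivalence using (to; from)

record Representatives {A : Set} (R : A → A → Set) (xs : List A) : Set where
  field
    reps     : List A
    reps⊆    : reps ⊆ xs
    distinct : AllPairs (λ u v → ¬ R u v) reps
    covers   : ∀ {x} → x ∈ xs → Any (R x) reps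
    shorter  : length reps ≤ length xs

-- Classically every list has representatives modulo a reflexive relation;
-- this removes repeated literals from clauses and repeated clauses from CNFs.
representatives : ∀ {A : Set} (R : A → A → Set) → (∀ x → R x x) →
                  ∀ xs → ¬ ¬ Representatives R xs
representatives R R-refl [] =
  pure (record { reps = [] ; reps⊆ = λ () ; distinct = [] ; covers = λ () ; shorter = z≤n })
representatives R R-refl (x ∷ xs) = do
  r ← representatives R R-refl xs
  x-covered? ← ¬¬-excluded-middle
  pure (extend r x-covered?)
  where
  extend : (r : Representatives R xs) → Dec (Any (R x) (Representatives.reps r)) →
           Representatives R (x ∷ xs)
  extend r (yes x-covered) = record
    { reps = reps ; reps⊆ = there ∘ reps⊆ ; distinct = distinct
    ; covers = λ { (here refl) → x-covered ; (there y∈) → covers y∈ }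
    ; shorter = m≤n⇒m≤1+n shorter }
    where open Representatives r
  extend r (no x-new) = record
    { reps = x ∷ reps
    ; reps⊆ = λ { (here refl) → here refl ; (there y∈) → there (reps⊆ y∈) }
    ; distinct = ¬Any⇒All¬ reps x-new ∷ distinct
    ; covers = λ { (here refl) → here (R-refl x) ; (there y∈) → there (covers y∈) }
    ; shorter = s≤s shorter }
    where open Representatives r

only : ∀ {n} → Fin n → Fin n → Bool
only i j = does (i ≟ j)

only-self : ∀ {n} (i : Fin n) → only i i ≡ true
only-self i = dec-true (i ≟ i) refl

only-true : ∀ {n} {i j : Fin n} → only i j ≡ true → i ≡ j
only-true {i = i} {j} _ with yes i≡j ← i ≟ j = i≡j

AMO-only : ∀ {n} (i : Fin n) → AMO (only i)
AMO-only i j j' j-set j'-set = trans (sym (only-true {i = i} j-set)) (only-true j'-set)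

AMO-none : ∀ {n} → AMO {n} (λ _ → false)
AMO-none _ _ ()

AMO⇒only : ∀ {n} {α : Fin n → Bool} {i} → AMO α → α i ≡ true → ∀ j → only i j ≡ α j
AMO⇒only {i = i} amo αi j with i ≟ j
... | yes refl = sym αi
AMO⇒only {α = α} {i} amo αi j | no i≢j with α j in αj
... | true  = contradiction (amo i j αi αj) i≢j
... | false = refl

module _ {n ℓ : ℕ} where

  evalVar-cong : ∀ {α α' : Fin n → Bool} {β β' : Fin ℓ → Bool} →
                 (∀ i → α i ≡ α' i) → (∀ j → β j ≡ β' j) →
                 ∀ (v : Var n ℓ) → evalVar α β v ≡ evalVar α' β' v
  evalVar-cong α≗α' β≗β' (inj₁ i) = α≗α' i
  evalVar-cong α≗α' β≗β' (inj₂ j) = β≗β' j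

  evalLit-cong : ∀ {α α' : Fin n → Bool} {β β' : Fin ℓ → Bool} →
                 (∀ i → α i ≡ α' i) → (∀ j → β j ≡ β' j) →
                 ∀ (l : Lit n ℓ) → evalLit α β l ≡ evalLit α' β' l
  evalLit-cong α≗α' β≗β' (pos v) = evalVar-cong α≗α' β≗β' v
  evalLit-cong α≗α' β≗β' (neg v) = cong not (evalVar-cong α≗α' β≗β' v)

  SatCNF-cong : ∀ {α α' : Fin n → Bool} {β β' : Fin ℓ → Bool} →
                (∀ i → α i ≡ α' i) → (∀ j → β j ≡ β' j) →
                ∀ {φ : CNF n ℓ} → SatCNF α β φ → SatCNF α' β' φ
  SatCNF-cong α≗α' β≗β' =
    All.map (Any.map (λ {l} → trans (sym (evalLit-cong α≗α' β≗β' l))))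

  _≋_ : CNF n ℓ → CNF n ℓ → Set
  φ ≋ ψ = ∀ α β → SatCNF α β φ ⇔ SatCNF α β ψ

  Encodes-resp-≋ : ∀ {φ ψ : CNF n ℓ} {f : (Fin n → Bool) → Set} →
                   φ ≋ ψ → Encodes φ f → Encodes ψ f
  Encodes-resp-≋ φ≋ψ enc α =
      (λ fα → let (β , sat) = proj₁ (enc α) fα in β , to (φ≋ψ α β) sat)
    , λ { (β , sat) → proj₂ (enc α) (β , from (φ≋ψ α β) sat) }

  Valid : Clause n ℓ → Set
  Valid D = ∀ α β → SatClause α β D

  Complementary : Clause n ℓ → Set
  Complementary D = ∃ λ v → pos v ∈ D × neg v ∈ D

  complementary⇒valid : ∀ {D : Clause n ℓ} → Complementary D → Valid D
  complementary⇒valid (v , pos∈ , neg∈) α β with evalVar α β v in eq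
  ... | true  = lose pos∈ eq
  ... | false = lose neg∈ (cong not eq)

  record CleanClause (D : Clause n ℓ) : Set where
    field
      clause  : Clause n ℓ
      wf      : WFClause clause
      shorter : length clause ≤ length D
      same    : ∀ α β → SatClause α β D ⇔ SatClause α β clause

  cleanClause : ∀ (D : Clause n ℓ) → ¬ ¬ (Valid D ⊎ CleanClause D)
  cleanClause D = ¬¬-excluded-middle {A = Complementary D} >>= λ
    { (yes pair) → pure (inj₁ (complementary⇒valid pair))
    ; (no no-pair) → do
        r ← representatives _≡_ (λ _ → refl) D
        pure (inj₂ (dedup no-pair r)) }
    where
    dedup : ¬ Complementary D → Representatives _≡_ D → CleanClause D
    dedup no-pair r = record
      { clause = reps
      ; wf = distinct , λ v (pos∈ , neg∈) → no-pair (v , reps⊆ pos∈ , reps⊆ neg∈)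
      ; shorter = shorter
      ; same = λ α β → mk⇔ (Any-resp-⊆ covers) (Any-resp-⊆ reps⊆) }
      where open Representatives r

  record Normalised (WF : CNF n ℓ → Set) (ψ : CNF n ℓ) : Set where
    field
      cnf        : CNF n ℓ
      wellFormed : WF cnf
      is2CNF     : Is2CNF cnf
      smaller    : size cnf ≤ size ψ
      equivalent : ψ ≋ cnf

  cleanClauses : ∀ (ψ : CNF n ℓ) → Is2CNF ψ → ¬ ¬ Normalised (All WFClause) ψ
  cleanClauses [] [] = pure (record
    { cnf = [] ; wellFormed = [] ; is2CNF = [] ; smaller = z≤n
    ; equivalent = λ _ _ → mk⇔ id id })
  cleanClauses (D ∷ ψ) (D≤2 ∷ ψ-2CNF) = do
    r ← cleanClauses ψ ψ-2CNF
    d ← cleanClause D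
    pure (add d r)
    where
    add : Valid D ⊎ CleanClause D → Normalised (All WFClause) ψ →
          Normalised (All WFClause) (D ∷ ψ)
    add (inj₁ valid) r = record
      { cnf = cnf ; wellFormed = wellFormed ; is2CNF = is2CNF
      ; smaller = m≤n⇒m≤1+n smaller
      ; equivalent = λ α β → mk⇔ (λ { (_ ∷ sat) → to (equivalent α β) sat })
                                 (λ sat → valid α β ∷ from (equivalent α β) sat) }
      where open Normalised r
    add (inj₂ c) r = record
      { cnf = clause ∷ cnf ; wellFormed = wf ∷ wellFormed
      ; is2CNF = ≤-trans shorter D≤2 ∷ is2CNF
      ; smaller = s≤s smaller
      ; equivalent = λ α β →
          mk⇔ (λ { (d ∷ sat) → to (same α β) d ∷ to (equivalent α β) sat })
              (λ { (d ∷ sat) → from (same α β) d ∷ from (equivalent α β) sat }) }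
      where open Normalised r
            open CleanClause c

  normalise : ∀ (ψ : CNF n ℓ) → Is2CNF ψ → ¬ ¬ Normalised WFCNF ψ
  normalise ψ ψ-2CNF = do
    r ← cleanClauses ψ ψ-2CNF
    d ← representatives _↭_ (λ _ → ↭-refl) (Normalised.cnf r)
    pure (dedup r d)
    where
    dedup : (r : Normalised (All WFClause) ψ) → Representatives _↭_ (Normalised.cnf r) →
            Normalised WFCNF ψ
    dedup r d = record
      { cnf = reps
      ; wellFormed = anti-mono reps⊆ wellFormed , distinct
      ; is2CNF = anti-mono reps⊆ is2CNF
      ; smaller = ≤-trans shorter smaller
      ; equivalent = λ α β →
          mk⇔ (anti-mono reps⊆ ∘ to (equivalent α β))
              (λ sat → from (equivalent α β)
                 (All.tabulate (λ C∈ → All.lookupWith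
                   (λ satD C↭D → Any-resp-↭ (↭-sym C↭D) satD) sat (covers C∈)))) }
      where open Normalised r
            open Representatives d

  -- What an auxiliary variable may be replaced by: a constant or a literal.
  data Value : Set where
    const : Bool → Value
    lit   : Lit n ℓ → Value

  ⟦_⟧ : Value → (Fin n → Bool) → (Fin ℓ → Bool) → Bool
  ⟦ const b ⟧ α β = b
  ⟦ lit l ⟧   α β = evalLit α β l

  complement : Lit n ℓ → Lit n ℓ
  complement (pos v) = neg v
  complement (neg v) = pos v

  negate : Value → Value
  negate (const b) = const (not b)
  negate (lit l)   = lit (complement l)

  ⟦negate⟧ : ∀ V α β → ⟦ negate V ⟧ α β ≡ not (⟦ V ⟧ α β)
  ⟦negate⟧ (const b)     α β = refl
  ⟦negate⟧ (lit (pos v)) α β = refl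
  ⟦negate⟧ (lit (neg v)) α β = sym (not-involutive _)

  -- A clause after substitution: nothing if it has become true.
  SatMaybe : (Fin n → Bool) → (Fin ℓ → Bool) → Maybe (Clause n ℓ) → Set
  SatMaybe α β = MaybeAll.All (SatClause α β)

  _∷ᴹ_ : Maybe (Clause n ℓ) → CNF n ℓ → CNF n ℓ
  nothing ∷ᴹ ψ = ψ
  just D  ∷ᴹ ψ = D ∷ ψ

  ∷ᴹ-sat : ∀ α β m (ψ : CNF n ℓ) → SatCNF α β (m ∷ᴹ ψ) ⇔ (SatMaybe α β m × SatCNF α β ψ)
  ∷ᴹ-sat α β nothing  ψ = mk⇔ (nothing ,_) proj₂
  ∷ᴹ-sat α β (just D) ψ = mk⇔ (Product.map just id ∘ All.uncons)
                              (λ { (just d , sat) → d ∷ sat })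

  module Substitution (k : Fin ℓ) (V : Value) where

    substVar : Var n ℓ → Value
    substVar (inj₁ i) = lit (pos (inj₁ i))
    substVar (inj₂ j) with j ≟ k
    ... | yes _ = V
    ... | no _  = lit (pos (inj₂ j))

    substLit : Lit n ℓ → Value
    substLit (pos v) = substVar v
    substLit (neg v) = negate (substVar v)

    assign : (Fin n → Bool) → (Fin ℓ → Bool) → Fin ℓ → Bool
    assign α β = updateAt β k (λ _ → ⟦ V ⟧ α β)

    substVar-correct : ∀ α β v → evalVar α (assign α β) v ≡ ⟦ substVar v ⟧ α β
    substVar-correct α β (inj₁ i) = refl
    substVar-correct α β (inj₂ j) with j ≟ k
    ... | yes refl = updateAt-updates j β
    ... | no j≢k   = updateAt-minimal j k β j≢k

    substLit-correct : ∀ α β l → evalLit α (assign α β) l ≡ ⟦ substLit l ⟧ α β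
    substLit-correct α β (pos v) = substVar-correct α β v
    substLit-correct α β (neg v) =
      trans (cong not (substVar-correct α β v)) (sym (⟦negate⟧ (substVar v) α β))

    _∷?_ : Value → Maybe (Clause n ℓ) → Maybe (Clause n ℓ)
    const true  ∷? m = nothing
    const false ∷? m = m
    lit l       ∷? m = Maybe.map (l ∷_) m

    substClause : Clause n ℓ → Maybe (Clause n ℓ)
    substClause []      = just []
    substClause (a ∷ C) = substLit a ∷? substClause C

    substCNF : CNF n ℓ → CNF n ℓ
    substCNF []      = []
    substCNF (C ∷ φ) = substClause C ∷ᴹ substCNF φ

    ∷?-sat : ∀ α β W m → SatMaybe α β (W ∷? m) ⇔ (⟦ W ⟧ α β ≡ true ⊎ SatMaybe α β m)
    ∷?-sat α β (const true)  m        = mk⇔ (λ _ → inj₁ refl) (λ _ → nothing)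
    ∷?-sat α β (const false) m        = mk⇔ inj₂ [ (λ ()) , id ]
    ∷?-sat α β (lit l)       nothing  = mk⇔ (λ _ → inj₂ nothing) (λ _ → nothing)
    ∷?-sat α β (lit l)       (just D) =
      mk⇔ (λ { (just d) → Sum.map₂ just (Any.toSum d) })
          (λ d → just (Any.fromSum (Sum.map₂ MaybeAll.drop-just d)))

    substClause-correct : ∀ α β C → SatMaybe α β (substClause C) ⇔ SatClause α (assign α β) C
    substClause-correct α β [] = mk⇔ (λ { (just ()) }) (λ ())
    substClause-correct α β (a ∷ C) = begin
      SatMaybe α β (substLit a ∷? substClause C)
        ≈⟨ ∷?-sat α β (substLit a) (substClause C) ⟩
      (⟦ substLit a ⟧ α β ≡ true ⊎ SatMaybe α β (substClause C))
        ≈⟨ ≡-true-⇔ (sym (substLit-correct α β a)) ⊎-⇔ substClause-correct α β C ⟩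
      (evalLit α (assign α β) a ≡ true ⊎ SatClause α (assign α β) C)
        ≈⟨ mk⇔ Any.fromSum Any.toSum ⟩
      SatClause α (assign α β) (a ∷ C) ∎
      where
      open SetoidReasoning (⇔-setoid 0ℓ)
      ≡-true-⇔ : ∀ {b c : Bool} → b ≡ c → (b ≡ true) ⇔ (c ≡ true)
      ≡-true-⇔ b≡c = mk⇔ (trans (sym b≡c)) (trans b≡c)

    substCNF-correct : ∀ α β φ → SatCNF α β (substCNF φ) ⇔ SatCNF α (assign α β) φ
    substCNF-correct α β [] = mk⇔ (λ _ → []) (λ _ → [])
    substCNF-correct α β (C ∷ φ) = begin
      SatCNF α β (substClause C ∷ᴹ substCNF φ)
        ≈⟨ ∷ᴹ-sat α β (substClause C) (substCNF φ) ⟩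
      (SatMaybe α β (substClause C) × SatCNF α β (substCNF φ))
        ≈⟨ substClause-correct α β C ×-⇔ substCNF-correct α β φ ⟩
      (SatClause α (assign α β) C × SatCNF α (assign α β) φ)
        ≈⟨ mk⇔ (λ (c , sat) → c ∷ sat) All.uncons ⟩
      SatCNF α (assign α β) (C ∷ φ) ∎
      where open SetoidReasoning (⇔-setoid 0ℓ)

    substClause-shorter : ∀ C → MaybeAll.All (λ D → length D ≤ length C) (substClause C)
    substClause-shorter []      = just z≤n
    substClause-shorter (a ∷ C) = grow (substLit a) (substClause-shorter C)
      where
      grow : ∀ {c} W {m} → MaybeAll.All (λ D → length D ≤ c) m →
             MaybeAll.All (λ D → length D ≤ suc c) (W ∷? m)
      grow (const true)  _        = nothing
      grow (const false) shorter  = MaybeAll.map m≤n⇒m≤1+n shorter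
      grow (lit l)       nothing  = nothing
      grow (lit l)       (just h) = just (s≤s h)

    substCNF-2CNF : ∀ φ → Is2CNF φ → Is2CNF (substCNF φ)
    substCNF-2CNF [] [] = []
    substCNF-2CNF (C ∷ φ) (C≤2 ∷ φ-2CNF) with substClause C | substClause-shorter C
    ... | nothing | _      = substCNF-2CNF φ φ-2CNF
    ... | just D  | just h = ≤-trans h C≤2 ∷ substCNF-2CNF φ φ-2CNF

    substCNF-size : ∀ φ → size (substCNF φ) ≤ size φ
    substCNF-size [] = z≤n
    substCNF-size (C ∷ φ) with substClause C
    ... | nothing = m≤n⇒m≤1+n (substCNF-size φ)
    ... | just D  = s≤s (substCNF-size φ)

  data OnAux (k : Fin ℓ) : Lit n ℓ → Set where
    pos-y : OnAux k (pos (inj₂ k))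
    neg-y : OnAux k (neg (inj₂ k))

  forcing : Lit n ℓ → Value → Value
  forcing (pos _) V = V
  forcing (neg _) V = negate V

  forced : ∀ {k l} → OnAux k l → ∀ V α β →
           evalLit α (Substitution.assign k (forcing l V) α β) l ≡ ⟦ V ⟧ α β
  forced {k} pos-y V α β = updateAt-updates k β
  forced {k} neg-y V α β = trans (cong not (updateAt-updates k β))
                                 (trans (cong not (⟦negate⟧ V α β)) (not-involutive _))

  unchanged : ∀ {k l} → OnAux k l → ∀ V α β → evalLit α β l ≡ ⟦ V ⟧ α β →
              ∀ j → Substitution.assign k (forcing l V) α β j ≡ β j
  unchanged {k} l-on-k V α β l≡V j with j ≟ k
  ... | no j≢k = updateAt-minimal j k β j≢k
  unchanged pos-y V α β l≡V j | yes refl = trans (updateAt-updates j β) (sym l≡V)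
  unchanged neg-y V α β l≡V j | yes refl =
    trans (updateAt-updates j β)
          (trans (⟦negate⟧ V α β) (trans (cong not (sym l≡V)) (not-involutive _)))

  removal : ∀ {φ : CNF n ℓ} {C} → C ∈ φ → ∃ λ rest → φ ↭ C ∷ rest
  removal C∈φ with φ₁ , φ₂ , refl ← ∈-∃++ C∈φ = φ₁ ++ φ₂ , shift _ φ₁ φ₂

  -- Then fixing l to V in the clauses other
  -- than C gives a smaller encoding: impossible.
  eliminate : ∀ {φ : CNF n ℓ} {C k l} → IsMinimum2CNFEncodingAMO φ → C ∈ φ →
              OnAux k l → (V : Value) → (∀ α β β' → ⟦ V ⟧ α β ≡ ⟦ V ⟧ α β') →
              (∀ α → AMO α → ∃ λ β → SatCNF α β φ × evalLit α β l ≡ ⟦ V ⟧ α β) →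
              (∀ α β → evalLit α β l ≡ ⟦ V ⟧ α β → SatClause α β C) → ⊥
  eliminate {φ} {k = k} {l} ((_ , φ-2CNF , φ-encodes) , minimal) C∈φ l-on-k V V-input
            witness C-holds =
    normalise ψ ψ-2CNF λ r → let open Normalised r in
      <⇒≱ (≤-trans (s≤s (≤-trans smaller (substCNF-size rest)))
                   (≤-reflexive (sym (↭-length φ↭))))
          (minimal ℓ cnf (wellFormed , is2CNF , Encodes-resp-≋ equivalent ψ-encodes))
    where
    open Substitution k (forcing l V)
    rest = proj₁ (removal C∈φ)
    φ↭ = proj₂ (removal C∈φ)
    ψ = substCNF rest

    ψ-2CNF : Is2CNF ψ
    ψ-2CNF = substCNF-2CNF rest (All.tail (All-resp-↭ φ↭ φ-2CNF))

    ψ-encodes : Encodes ψ AMO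
    ψ-encodes α =
        (λ amo → let (β , sat , l≡V) = witness α amo in
           β , from (substCNF-correct α β rest)
                 (SatCNF-cong (λ _ → refl) (λ j → sym (unchanged l-on-k V α β l≡V j))
                   (All.tail (All-resp-↭ φ↭ sat))))
      , λ { (β , sat) → proj₂ (φ-encodes α)
              (assign α β , All-resp-↭ (↭-sym φ↭)
                 (C-holds α (assign α β) (trans (forced l-on-k V α β) (V-input α β (assign α β)))
                  ∷ to (substCNF-correct α β rest) sat)) }

  -- In a well-formed clause of at most two literals containing x_i, the
  -- partner of x_i: the other literal, or x_i itself for a unit clause.
  record Partner (i : Fin n) (C : Clause n ℓ) : Set where
    field
      other     : Lit n ℓ
      other∈C   : other ∈ C
      other≢¬xᵢ : other ≢ neg (inj₁ i)
      split     : ∀ α β → SatClause α β C → α i ≡ true ⊎ evalLit α β other ≡ true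

  other-literal : ∀ {i} {C : Clause n ℓ} → length C ≤ 2 → pos (inj₁ i) ∈ C →
                  ∃ λ m → m ∈ C × (∀ α β → SatClause α β C → α i ≡ true ⊎ evalLit α β m ≡ true)
  other-literal {C = a ∷ []}     _ (here refl) = a , here refl , λ { α β (here t) → inj₁ t }
  other-literal {C = a ∷ b ∷ []} _ (here refl) =
    b , there (here refl) , λ { α β (here t) → inj₁ t ; α β (there (here t)) → inj₂ t }
  other-literal {C = a ∷ b ∷ []} _ (there (here refl)) =
    a , here refl , λ { α β (here t) → inj₂ t ; α β (there (here t)) → inj₁ t }
  other-literal {C = a ∷ b ∷ []} _ (there (there ()))
  other-literal {C = _ ∷ _ ∷ _ ∷ _} (s≤s (s≤s ())) _

  partner : ∀ {i} {C : Clause n ℓ} → WFClause C → length C ≤ 2 → pos (inj₁ i) ∈ C → Partner i C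
  partner (_ , no-pair) C≤2 xᵢ∈C with other-literal C≤2 xᵢ∈C
  ... | m , m∈C , split = record
    { other = m ; other∈C = m∈C ; other≢¬xᵢ = λ { refl → no-pair _ (xᵢ∈C , m∈C) } ; split = split }

  -- The partner is not a positive input literal x_j: the all-zero input
  -- satisfies AMO but falsifies x_i ∨ x_j.
  partner≢pos-input : ∀ {φ : CNF n ℓ} {C i j} → Encodes φ AMO → C ∈ φ → (p : Partner i C) →
                      Partner.other p ≢ pos (inj₁ j)
  partner≢pos-input φ-encodes C∈φ p refl
    with β , sat ← proj₁ (φ-encodes (λ _ → false)) AMO-none
    with Partner.split p _ β (All.lookup sat C∈φ)
  ... | inj₁ ()
  ... | inj₂ ()

  -- The partner is not a negative input literal ¬x_j (j ≠ i): the input with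
  -- only x_j set satisfies AMO but falsifies x_i ∨ ¬x_j.
  partner≢neg-input : ∀ {φ : CNF n ℓ} {C i j} → Encodes φ AMO → C ∈ φ → (p : Partner i C) →
                      Partner.other p ≢ neg (inj₁ j)
  partner≢neg-input {j = j} φ-encodes C∈φ p refl
    with β , sat ← proj₁ (φ-encodes (only j)) (AMO-only j)
    with Partner.split p _ β (All.lookup sat C∈φ)
  ... | inj₁ j≡i = Partner.other≢¬xᵢ p (cong (neg ∘ inj₁) (only-true j≡i))
  ... | inj₂ ¬xⱼ = contradiction (trans (sym (cong not (only-self j))) ¬xⱼ) λ ()

  -- If m can be
  -- true in a witness for the input with only x_i set, every AMO input has a
  -- witness with m true, and m := 1 eliminates C; otherwise every AMO input
  -- has a witness with m = ¬x_i, and m := ¬x_i eliminates C.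
  partner-not-aux : ∀ {φ : CNF n ℓ} {C i k} → IsMinimum2CNFEncodingAMO φ → C ∈ φ →
                    pos (inj₁ i) ∈ C → (p : Partner i C) → OnAux k (Partner.other p) → ⊥
  partner-not-aux {φ} {C} {i} minimum C∈φ xᵢ∈C p m-on-k = ¬¬-excluded-middle {A = Settable} λ
    { (yes settable) → eliminate minimum C∈φ m-on-k (const true) (λ _ _ _ → refl)
                                 (witness-true settable) (λ _ _ m-true → lose other∈C m-true)
    ; (no unsettable) → eliminate minimum C∈φ m-on-k (lit (neg (inj₁ i))) (λ _ _ _ → refl)
                                 (witness-¬xᵢ unsettable) C-holds }
    where
    open Partner p
    φ-encodes = proj₂ (proj₂ (proj₁ minimum))

    Settable : Set
    Settable = ∃ λ β → SatCNF (only i) β φ × evalLit (only i) β other ≡ true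

    m-true-off-xᵢ : ∀ {α β} → α i ≡ false → SatCNF α β φ → evalLit α β other ≡ true
    m-true-off-xᵢ αi sat with split _ _ (All.lookup sat C∈φ)
    ... | inj₁ αi≡true = contradiction (trans (sym αi) αi≡true) λ ()
    ... | inj₂ m-true  = m-true

    witness-true : Settable → ∀ α → AMO α → ∃ λ β → SatCNF α β φ × evalLit α β other ≡ true
    witness-true (β , sat , m-true) α amo with α i in αi
    ... | true  = β , SatCNF-cong (AMO⇒only amo αi) (λ _ → refl) sat
                    , trans (sym (evalLit-cong (AMO⇒only amo αi) (λ _ → refl) other)) m-true
    ... | false with β' , sat' ← proj₁ (φ-encodes α) amo = β' , sat' , m-true-off-xᵢ αi sat'

    witness-¬xᵢ : ¬ Settable → ∀ α → AMO α →
                  ∃ λ β → SatCNF α β φ × evalLit α β other ≡ not (α i)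
    witness-¬xᵢ unsettable α amo with β , sat ← proj₁ (φ-encodes α) amo | α i in αi
    ... | false = β , sat , m-true-off-xᵢ αi sat
    ... | true with evalLit α β other in m-value
    ...   | false = β , sat , m-value
    ...   | true  = contradiction
                      ( β , SatCNF-cong (λ j → sym (AMO⇒only amo αi j)) (λ _ → refl) sat
                      , trans (evalLit-cong (AMO⇒only amo αi) (λ _ → refl) other) m-value )
                      unsettable

    C-holds : ∀ α β → evalLit α β other ≡ not (α i) → SatClause α β C
    C-holds α β m≡¬xᵢ with α i in αi
    ... | true  = lose xᵢ∈C αi
    ... | false = lose other∈C m≡¬xᵢ

  no-partner : ∀ {φ : CNF n ℓ} {C i} → IsMinimum2CNFEncodingAMO φ → C ∈ φ →
               pos (inj₁ i) ∈ C → Partner i C → ⊥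
  no-partner minimum@((_ , _ , φ-encodes) , _) C∈φ xᵢ∈C p with Partner.other p in m≡
  ... | pos (inj₁ j) = partner≢pos-input φ-encodes C∈φ p m≡
  ... | neg (inj₁ j) = partner≢neg-input φ-encodes C∈φ p m≡
  ... | pos (inj₂ k) = partner-not-aux minimum C∈φ xᵢ∈C p (subst (OnAux k) (sym m≡) pos-y)
  ... | neg (inj₂ k) = partner-not-aux minimum C∈φ xᵢ∈C p (subst (OnAux k) (sym m≡) neg-y)

lemma21 : ∀ (n ℓ : ℕ) (φ : CNF n ℓ) → IsMinimum2CNFEncodingAMO φ →
    All (λ C → ∀ (i : Fin n) → pos (inj₁ i) ∉ C) φ
lemma21 n ℓ φ minimum@((φ-wf , φ-2CNF , _) , _) =
  All.tabulate λ C∈φ i xᵢ∈C →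
    no-partner minimum C∈φ xᵢ∈C (partner (All.lookup (proj₁ φ-wf) C∈φ) (All.lookup φ-2CNF C∈φ) xᵢ∈C)
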